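{- In the canonical model for $\mathbb{PCL}$, for all $(X,A),(Y,B)\in\mathcal{W}$ it holds that $S_X(Y,B)\subseteq U(X,A)$.
   Context: Formulas are built from atoms and $\bot$ by $\wedge,\vee,\rightarrow$ and a binary conditional $>$; $\neg G:=G\rightarrow\bot$. The axiom system of $\mathbb{PCL}$ consists of classical propositional tautologies, modus ponens, the rules (RCEA) from $A\leftrightarrow B$ infer $(A>C)\leftrightarrow(B>C)$ and (RCK) from $A\rightarrow B$ infer $(C>A)\rightarrow(C>B)$, and axioms (ID) $A>A$, (R-And) $(A>B)\wedge(A>C)\rightarrow(A>(B\wedge C))$, (CM) $(A>B)\wedge(A>C)\rightarrow((A\wedge B)>C)$, (OR) $(A>C)\wedge(B>C)\rightarrow((A\vee B)>C)$. Maximal consistent sets are relative to this system. For maximal consistent $X$: $X^B=\{C: B>C\in X\}$; $A\leq_X B$ iff $(A\vee B)>A\in X$. Canonical worlds $\mathcal{W}=\{(X,A): X \text{ maximal consistent}, A\in X\}$; $S_X(Y,B)=\{(Z,C)\in\mathcal{W}: X^C\subseteq Z,\ C\leq_X B,\ B\notin Z\}\cup\{(Y,B)\}$. The universe of $(X,A)$ is $U(X,A)=\{(Y,B)\in\mathcal{W} : \text{for all formulas } G,\ G>\bot\in X \text{ implies } \neg G\in Y\}$.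
   Formalization: The inclusion $S_X(Y,B)\subseteq U(X,A)$ is claimed only for those (Y,B) ∈ 𝒲 that themselves lie in U(X,A). The statement above fails without it. -}

module Defs where

open import Data.Nat using (ℕ)
open import Data.Bool using (Bool; true; false; _∧_; _∨_; not)
open import Data.List using (List; []; _∷_)
open import Data.List.Relation.Unary.All using (All)
open import Data.Product using (Σ; _×_; _,_)
open import Data.Sum using (_⊎_)
open import Relation.Binary.PropositionalEquality using (_≡_)
open import Relation.Nullary using (¬_)

infixr 6 _∧'_
infixr 5 _∨'_
infixr 4 _⇒'_
infix 7 _>'_

data Fm : Set where
  atom : ℕ → Fm
  ⊥'   : Fm
  _∧'_ : Fm → Fm → Fm
  _∨'_ : Fm → Fm → Fm
  _⇒'_ : Fm → Fm → Fm
  _>'_ : Fm → Fm → Fm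

¬' : Fm → Fm
¬' G = G ⇒' ⊥'

⊤' : Fm
⊤' = ⊥' ⇒' ⊥'

_⇔'_ : Fm → Fm → Fm
A ⇔' B = (A ⇒' B) ∧' (B ⇒' A)

-- Classical (Boolean) evaluation, with conditional subformulas treated as
-- propositional atoms (their truth value given by c).
eval : (ℕ → Bool) → (Fm → Fm → Bool) → Fm → Bool
eval v c (atom n) = v n
eval v c ⊥' = false
eval v c (A ∧' B) = eval v c A ∧ eval v c B
eval v c (A ∨' B) = eval v c A ∨ eval v c B
eval v c (A ⇒' B) = not (eval v c A) ∨ eval v c B
eval v c (A >' B) = c A B

Tautology : Fm → Set
Tautology A = ∀ (v : ℕ → Bool) (c : Fm → Fm → Bool) → eval v c A ≡ true

data ⊢_ : Fm → Set where
  taut  : ∀ {A} → Tautology A → ⊢ A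
  mp    : ∀ {A B} → ⊢ (A ⇒' B) → ⊢ A → ⊢ B
  rcea  : ∀ {A B C} → ⊢ (A ⇔' B) → ⊢ ((A >' C) ⇔' (B >' C))
  rck   : ∀ {A B C} → ⊢ (A ⇒' B) → ⊢ ((C >' A) ⇒' (C >' B))
  ax-id : ∀ {A} → ⊢ (A >' A)
  r-and : ∀ {A B C} → ⊢ (((A >' B) ∧' (A >' C)) ⇒' (A >' (B ∧' C)))
  cm    : ∀ {A B C} → ⊢ (((A >' B) ∧' (A >' C)) ⇒' ((A ∧' B) >' C))
  or    : ∀ {A B C} → ⊢ (((A >' C) ∧' (B >' C)) ⇒' ((A ∨' B) >' C))

FmSet : Set₁
FmSet = Fm → Set

_∪｛_｝ : FmSet → Fm → FmSet
(X ∪｛ A ｝) B = X B ⊎ B ≡ A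

conj : List Fm → Fm
conj [] = ⊤'
conj (A ∷ L) = A ∧' conj L

Consistent : FmSet → Set
Consistent X = ¬ (Σ (List Fm) λ L → All X L × ⊢ (conj L ⇒' ⊥'))

MaxCons : FmSet → Set
MaxCons X = Consistent X × (∀ A → Consistent (X ∪｛ A ｝) → X A)

sup : FmSet → Fm → FmSet
sup X B C = X (B >' C)

_≤[_]_ : Fm → FmSet → Fm → Set
A ≤[ X ] B = X ((A ∨' B) >' A)

InW : FmSet → Fm → Set
InW X A = MaxCons X × X A

SameWorld : FmSet → Fm → FmSet → Fm → Set
SameWorld Z C Y B = (∀ D → (Z D → Y D) × (Y D → Z D)) × C ≡ B

InS : FmSet → FmSet → Fm → FmSet → Fm → Set
InS X Y B Z C =
  (InW Z C × (∀ D → sup X C D → Z D) × C ≤[ X ] B × ¬ Z B)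
  ⊎ SameWorld Z C Y B

InU : FmSet → Fm → FmSet → Fm → Set
InU X A Y B = InW Y B × (∀ G → X (G >' ⊥') → Y (¬' G))

-- If G > ⊥ ∈ X then, for every C, the logic derives C > ¬G (split C into C ∧ ¬G, which
-- yields ¬G by (ID), and C ∧ G, which yields ⊥ by (CM); recombine by (OR)). So ¬G ∈ X^C,
-- and every world of S_X(Y,B) other than (Y,B) itself contains X^C. The remaining
-- world (Y,B) lies in U(X,A) by hypothesis, and both notions respect extensional
-- equality of maximal consistent sets.
module Submission where

open import Defs
open import Data.Bool using (true; false; _∧_; _∨_; not)
open import Data.List using (List; []; _∷_)
open import Data.List.Relation.Unary.All using (All; []; _∷_) renaming (map to All-map)
open import Data.Product using (Σ; _×_; _,_; proj₁; proj₂)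
open import Data.Sum using (inj₁; inj₂)
open import Relation.Binary.PropositionalEquality using (_≡_; refl)

module Boolean where

  identity : ∀ a → not a ∨ a ≡ true
  identity true = refl
  identity false = refl

  ex-falso : ∀ a → not false ∨ a ≡ true
  ex-falso _ = refl

  weakening : ∀ a b → not a ∨ (not b ∨ a) ≡ true
  weakening true true = refl
  weakening true false = refl
  weakening false _ = refl

  iff-to-implication : ∀ a b → not ((not a ∨ b) ∧ (not b ∨ a)) ∨ (not a ∨ b) ≡ true
  iff-to-implication true true = refl
  iff-to-implication true false = refl
  iff-to-implication false true = refl
  iff-to-implication false false = refl

  syllogism : ∀ a b c → not (not a ∨ b) ∨ (not (not b ∨ c) ∨ (not a ∨ c)) ≡ true
  syllogism true true true = refl
  syllogism true true false = refl
  syllogism true false true = refl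
  syllogism true false false = refl
  syllogism false true true = refl
  syllogism false true false = refl
  syllogism false false true = refl
  syllogism false false false = refl

  pairing : ∀ a b c → not (not a ∨ b) ∨ (not (not a ∨ c) ∨ (not a ∨ (b ∧ c))) ≡ true
  pairing true true true = refl
  pairing true true false = refl
  pairing true false true = refl
  pairing true false false = refl
  pairing false true true = refl
  pairing false true false = refl
  pairing false false true = refl
  pairing false false false = refl

  conjunction-mono : ∀ a b c d →
    not (not a ∨ b) ∨ (not (not c ∨ d) ∨ (not (a ∧ c) ∨ (b ∧ d))) ≡ true
  conjunction-mono true true true true = refl
  conjunction-mono true true true false = refl
  conjunction-mono true true false _ = refl
  conjunction-mono true false true true = refl
  conjunction-mono true false true false = refl
  conjunction-mono true false false _ = refl
  conjunction-mono false _ true true = refl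
  conjunction-mono false _ true false = refl
  conjunction-mono false _ false _ = refl

  conjunction-comm : ∀ a b → (not (a ∧ b) ∨ (b ∧ a)) ∧ (not (b ∧ a) ∨ (a ∧ b)) ≡ true
  conjunction-comm true true = refl
  conjunction-comm true false = refl
  conjunction-comm false true = refl
  conjunction-comm false false = refl

  conjunction-proj₂ : ∀ a b → not (a ∧ (not b ∨ false)) ∨ (not b ∨ false) ≡ true
  conjunction-proj₂ true true = refl
  conjunction-proj₂ true false = refl
  conjunction-proj₂ false _ = refl

  case-split : ∀ a b →
    (not ((a ∧ (not b ∨ false)) ∨ (a ∧ b)) ∨ a) ∧ (not a ∨ ((a ∧ (not b ∨ false)) ∨ (a ∧ b)))
    ≡ true
  case-split true true = refl
  case-split true false = refl
  case-split false true = refl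
  case-split false false = refl

⊢-refl : ∀ {A} → ⊢ (A ⇒' A)
⊢-refl {A} = taut λ v c → Boolean.identity (eval v c A)

⊢-efq : ∀ {A} → ⊢ (⊥' ⇒' A)
⊢-efq {A} = taut λ v c → Boolean.ex-falso (eval v c A)

⊢-const : ∀ {A B} → ⊢ A → ⊢ (B ⇒' A)
⊢-const {A} {B} ⊢A = mp (taut λ v c → Boolean.weakening (eval v c A) (eval v c B)) ⊢A

⊢-⇔⇒⇒ : ∀ {A B} → ⊢ (A ⇔' B) → ⊢ (A ⇒' B)
⊢-⇔⇒⇒ {A} {B} ⊢A⇔B = mp (taut λ v c → Boolean.iff-to-implication (eval v c A) (eval v c B)) ⊢A⇔B

⊢-trans : ∀ {A B C} → ⊢ (A ⇒' B) → ⊢ (B ⇒' C) → ⊢ (A ⇒' C)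
⊢-trans {A} {B} {C} p q =
  mp (mp (taut λ v c → Boolean.syllogism (eval v c A) (eval v c B) (eval v c C)) p) q

⊢-pair : ∀ {A B C} → ⊢ (A ⇒' B) → ⊢ (A ⇒' C) → ⊢ (A ⇒' (B ∧' C))
⊢-pair {A} {B} {C} p q =
  mp (mp (taut λ v c → Boolean.pairing (eval v c A) (eval v c B) (eval v c C)) p) q

⊢-∧-mono : ∀ {A B C D} → ⊢ (A ⇒' B) → ⊢ (C ⇒' D) → ⊢ ((A ∧' C) ⇒' (B ∧' D))
⊢-∧-mono {A} {B} {C} {D} p q =
  mp (mp (taut λ v c → Boolean.conjunction-mono (eval v c A) (eval v c B) (eval v c C) (eval v c D)) p) q

⊢-rcea⇒ : ∀ {A B C} → Tautology (A ⇔' B) → ⊢ ((A >' C) ⇒' (B >' C))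
⊢-rcea⇒ A⇔B = ⊢-⇔⇒⇒ (rcea (taut A⇔B))

⊢-impossible⇒>⊥ : ∀ G C → ⊢ ((G >' ⊥') ⇒' ((C ∧' G) >' ⊥'))
⊢-impossible⇒>⊥ G C = ⊢-trans (⊢-pair (rck ⊢-efq) ⊢-refl) (⊢-trans cm swap)
  where
  swap : ⊢ (((G ∧' C) >' ⊥') ⇒' ((C ∧' G) >' ⊥'))
  swap = ⊢-rcea⇒ λ v c → Boolean.conjunction-comm (eval v c G) (eval v c C)

⊢-impossible⇒>¬ : ∀ G C → ⊢ ((G >' ⊥') ⇒' (C >' ¬' G))
⊢-impossible⇒>¬ G C = ⊢-trans (⊢-trans (⊢-pair (⊢-const ¬G-case) G-case) or) recombine
  where
  ¬G-case : ⊢ ((C ∧' ¬' G) >' ¬' G)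
  ¬G-case = mp (rck (taut λ v c → Boolean.conjunction-proj₂ (eval v c C) (eval v c G))) ax-id
  G-case : ⊢ ((G >' ⊥') ⇒' ((C ∧' G) >' ¬' G))
  G-case = ⊢-trans (⊢-impossible⇒>⊥ G C) (rck ⊢-efq)
  recombine : ⊢ ((((C ∧' ¬' G) ∨' (C ∧' G)) >' ¬' G) ⇒' (C >' ¬' G))
  recombine = ⊢-rcea⇒ λ v c → Boolean.case-split (eval v c C) (eval v c G)

replace-derivable : ∀ {X : FmSet} {P Q} → X P → ⊢ (P ⇒' Q) → ∀ L → All (X ∪｛ Q ｝) L →
  Σ (List Fm) λ L' → All X L' × ⊢ (conj L' ⇒' conj L)
replace-derivable xP P⇒Q [] [] = [] , [] , ⊢-refl
replace-derivable xP P⇒Q (D ∷ L) (D∈ ∷ L⊆) with replace-derivable xP P⇒Q L L⊆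
... | L' , L'⊆X , L'⇒L with D∈
...   | inj₁ xD = D ∷ L' , xD ∷ L'⊆X , ⊢-∧-mono ⊢-refl L'⇒L
...   | inj₂ refl = _ ∷ L' , xP ∷ L'⊆X , ⊢-∧-mono P⇒Q L'⇒L

MaxCons-closed : ∀ {X : FmSet} {P Q} → MaxCons X → X P → ⊢ (P ⇒' Q) → X Q
MaxCons-closed {X} (consistent , maximal) xP P⇒Q = maximal _ λ where
  (L , L⊆ , L⇒⊥) → let L' , L'⊆X , L'⇒L = replace-derivable {X} xP P⇒Q L L⊆
                   in consistent (L' , L'⊆X , ⊢-trans L'⇒L L⇒⊥)

_≐_ : FmSet → FmSet → Set
Y ≐ Z = ∀ D → (Y D → Z D) × (Z D → Y D)

≐-∪｛｝ : ∀ {Y Z D} → Y ≐ Z → ∀ {E} → (Y ∪｛ D ｝) E → (Z ∪｛ D ｝) E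
≐-∪｛｝ Y≐Z (inj₁ yE) = inj₁ (proj₁ (Y≐Z _) yE)
≐-∪｛｝ Y≐Z (inj₂ E≡D) = inj₂ E≡D

MaxCons-resp-≐ : ∀ {Y Z} → Y ≐ Z → MaxCons Y → MaxCons Z
MaxCons-resp-≐ Y≐Z (consistent , maximal) =
    (λ where (L , L⊆Z , L⇒⊥) → consistent (L , All-map (proj₂ (Y≐Z _)) L⊆Z , L⇒⊥))
  , (λ D cons → proj₁ (Y≐Z D) (maximal D λ where
       (L , L⊆ , L⇒⊥) → cons (L , All-map (≐-∪｛｝ Y≐Z) L⊆ , L⇒⊥)))

InU-resp-SameWorld : ∀ {X A Y B Z C} → SameWorld Z C Y B → InU X A Y B → InU X A Z C
InU-resp-SameWorld (Z≐Y , refl) ((mcY , yB) , univ) =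
  (MaxCons-resp-≐ Y≐Z mcY , proj₁ (Y≐Z _) yB) , λ G xG → proj₁ (Y≐Z (¬' G)) (univ G xG)
  where
  Y≐Z : _ ≐ _
  Y≐Z D = proj₂ (Z≐Y D) , proj₁ (Z≐Y D)

InU-of-sup⊆ : ∀ {X A Z C} → MaxCons X → InW Z C → (∀ D → sup X C D → Z D) → InU X A Z C
InU-of-sup⊆ {X} {C = C} mcX wZ X^C⊆Z =
  wZ , λ G xG → X^C⊆Z (¬' G) (MaxCons-closed {X} mcX xG (⊢-impossible⇒>¬ G C))

mainTheorem8 : ∀ (X : FmSet) (A : Fm) (Y : FmSet) (B : Fm)
               → InW X A → InW Y B → InU X A Y B
               → ∀ (Z : FmSet) (C : Fm) → InS X Y B Z C → InU X A Z C
mainTheorem8 X A Y B (mcX , _) _ _ Z C (inj₁ (wZ , X^C⊆Z , _ , _)) = InU-of-sup⊆ {X} {A} mcX wZ X^C⊆Z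
mainTheorem8 X A Y B _ _ uY Z C (inj₂ same) = InU-resp-SameWorld {X} {A} same uY
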